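{- Let $b_0,b_1,\ldots$ and $\lambda_1,\lambda_2,\ldots$ be independent indeterminates and let $R=\mathbb{Z}[b,b^{ -1},\lambda]$ be the ring of polynomials in the $\lambda_k$ and Laurent polynomials in the $b_k$. Define $\mu_m\in R$ for all integers $m$ as follows: for $m\geq 0$, $\mu_m=\sum_\omega \mathrm{wt}(\omega)$ over all Schröder paths $\omega$ ending at $(m,0)$; for $m\geq 1$, $\mu_{ -m}=\sum_\omega \overline{\mathrm{wt}}(\omega)$ over all Schröder paths $\omega$ ending at $(m,0)$ whose first step is an $E$ step. Then for every $n\geq 0$ the Toeplitz matrix $(\mu_{i-j})_{0\leq i,j\leq n}$ has special Smith normal form $$\mathrm{diag}\Big(1,-\frac{\lambda_1}{b_1},\frac{\lambda_1\lambda_2}{b_1b_2},\ldots,(-1)^n\frac{\lambda_1\lambda_2\cdots\lambda_n}{b_1b_2\cdots b_n}\Big)$$ over $R$.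
   Context: A Schröder path is a lattice path starting at the origin $(0,0)$, ending on the $x$-axis, never going below the $x$-axis, each step of which is one of: $NE:(x,k)\to(x+1/2,k+1)$; $E:(x,k)\to(x+1,k)$; $SE:(x,k)\to(x+1/2,k-1)$. Step weights: $\mathrm{wt}(NE)=1$, $\mathrm{wt}$ of an $E$ step at height $k$ is $1/b_k$, $\mathrm{wt}$ of an $SE$ step from height $k$ to $k-1$ is $\lambda_k/(b_{k-1}b_k)$; and $\overline{\mathrm{wt}}(NE)=1$, $\overline{\mathrm{wt}}$ of an $E$ step at height $k$ is $b_k$, $\overline{\mathrm{wt}}$ of an $SE$ step from height $k$ is $\lambda_k$. The weight of a path is the product of the weights of its steps (the empty path has weight $1$). (These $\mu_m$ are the moments $\mathcal L(z^m)$ of the linear functional $\mathcal L$ on $R[z,z^{ -1}]$ with $\mathcal L(1)=1$ and $\mathcal L(z^m q_n(1/z))=0$ for $0\leq m<n$, where $q_{n+1}(z)=(z-b_n)q_n(z)-z\lambda_nq_{n-1}(z)$, $q_{ -1}=0$, $q_0=1$.) For an $m\times n$ matrix $A$ over a commutative ring $R$, a matrix $D$ is a special Smith normal form (SSNF) of $A$ over $R$ if there exist $P\in \mathrm{SL}(m,R)$, $Q\in\mathrm{SL}(n,R)$ with $PAQ=D$, $D$ is diagonal, and $d_{ii}$ is a multiple in $R$ of $d_{jj}$ whenever $i\geq j$. -}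

module Defs where

open import Level using (Level; _⊔_)
open import Algebra.Bundles using (CommutativeRing)
open import Data.Nat using (ℕ; zero; suc; _≤_)
import Data.Nat as ℕ
open import Data.Integer using (ℤ; +_; -[1+_]; _⊖_)
open import Data.Fin using (Fin; zero; suc; toℕ; punchIn)
import Data.Fin as Fin
open import Data.Product using (Σ; _×_)
open import Relation.Nullary using (¬_; yes; no)
open import Relation.Binary.PropositionalEquality using (_≡_)

module WithRing {c ℓ : Level} (R : CommutativeRing c ℓ) where
  open CommutativeRing R using (Carrier; _≈_; _+_; _*_; -_; 0#; 1#)

  Matrix : ℕ → ℕ → Set c
  Matrix m n = Fin m → Fin n → Carrier

  Σ[_] : (n : ℕ) → (Fin n → Carrier) → Carrier
  Σ[ zero ] f = 0#
  Σ[ suc n ] f = f zero + Σ[ n ] (λ j → f (suc j))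

  _⊗_ : {m n p : ℕ} → Matrix m n → Matrix n p → Matrix m p
  _⊗_ {n = n} A B i k = Σ[ n ] (λ j → A i j * B j k)

  alt : ℕ → Carrier
  alt zero = 1#
  alt (suc k) = - alt k

  det : (n : ℕ) → Matrix n n → Carrier
  det zero A = 1#
  det (suc n) A = Σ[ suc n ] (λ j → alt (toℕ j) * (A zero j * det n (λ r s → A (suc r) (punchIn j s))))

  InSL : (n : ℕ) → Matrix n n → Set ℓ
  InSL n M = det n M ≈ 1#

  _≋_ : {m n : ℕ} → Matrix m n → Matrix m n → Set ℓ
  A ≋ B = ∀ i j → A i j ≈ B i j

  IsDiagonal : {n : ℕ} → Matrix n n → Set ℓ
  IsDiagonal D = ∀ i j → ¬ (i ≡ j) → D i j ≈ 0#

  _∣ᴿ_ : Carrier → Carrier → Set (c ⊔ ℓ)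
  y ∣ᴿ x = Σ Carrier (λ q → x ≈ q * y)

  IsSSNF : (n : ℕ) → Matrix n n → Matrix n n → Set (c ⊔ ℓ)
  IsSSNF n A D =
    Σ (Matrix n n) λ P → Σ (Matrix n n) λ Q →
      InSL n P × InSL n Q × ((P ⊗ A) ⊗ Q) ≋ D × IsDiagonal D
      × (∀ (i j : Fin n) → toℕ j ≤ toℕ i → D j j ∣ᴿ D i i)

  -- Weighted sum over Schröder paths starting at height h with total
  -- horizontal length k/2 (k counts half-units) ending on the x-axis and
  -- never going below it.  NE steps have weight 1, an E step at height h has
  -- weight e h, an SE step from height (suc h) to h has weight s h.
  schroeder : (e s : ℕ → Carrier) → ℕ → ℕ → Carrier
  schroeder e s zero zero = 1#
  schroeder e s zero (suc h) = 0#
  schroeder e s (suc zero) zero = schroeder e s zero 1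
  schroeder e s (suc zero) (suc h) =
    schroeder e s zero (suc (suc h)) + s h * schroeder e s zero h
  schroeder e s (suc (suc k)) zero =
    schroeder e s (suc k) 1 + e 0 * schroeder e s k 0
  schroeder e s (suc (suc k)) (suc h) =
    (schroeder e s (suc k) (suc (suc h)) + s h * schroeder e s (suc k) h)
    + e (suc h) * schroeder e s k (suc h)

  -- Parameters: b k = b_k, binv k = b_k^{-1}, lam k = λ_{k+1}.
  module Moments (b binv lam : ℕ → Carrier) where
    wtE wtSE : ℕ → Carrier
    wtE h = binv h
    wtSE h = lam h * (binv h * binv (suc h))
    bwtE bwtSE : ℕ → Carrier
    bwtE h = b h
    bwtSE h = lam h

    -- μ_m (m ≥ 0): sum of wt over Schröder paths ending at (m,0);
    -- μ_{-(m+1)}: sum of wt-bar over Schröder paths ending at (m+1,0) whose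
    -- first step is E (that step is at height 0, weight b_0, followed by an
    -- arbitrary Schröder path of length m).
    μ : ℤ → Carrier
    μ (+ m) = schroeder wtE wtSE (2 ℕ.* m) 0
    μ -[1+ m ] = bwtE 0 * schroeder bwtE bwtSE (2 ℕ.* m) 0

    toeplitz : (n : ℕ) → Matrix (suc n) (suc n)
    toeplitz n i j = μ (toℕ i ⊖ toℕ j)

    d : ℕ → Carrier
    d zero = 1#
    d (suc k) = - (lam k * binv (suc k)) * d k

    diagMat : (n : ℕ) → Matrix (suc n) (suc n)
    diagMat n i j with i Fin.≟ j
    ... | yes _ = d (toℕ i)
    ... | no _ = 0#

module Submission where

-- Let q_0 = 1, q_{k+1}(z) = (z - b_k) q_k(z) - z λ_k q_{k-1}(z), and pair the moments with a polynomial p of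
-- degree at most n by ⟨ m ∣ p ⟩ = Σ_j μ_{m-j} p_j.  If Q is the upper unitriangular matrix whose k-th column
-- lists the coefficients of q_k, then (T Q)_{l,k} = ⟨ l ∣ q_k ⟩ for the Toeplitz matrix T = (μ_{i-j}).
-- The heart of the proof is a closed form for ⟨ m ∣ q_k ⟩, valid for every integer m: it is d_k times the
-- weight of the paths from height 0 to height k of half-length 2m - k when m ≥ 0, and b_0 λ_1⋯λ_k times
-- the bar-weight of those of half-length 2j + k when m = -(j+1).  It follows by induction on k, because the
-- pairing satisfies the three-term recurrence of the q_k and the path counts satisfy the same recurrence
-- by a last-step decomposition (this is where b_k b_k⁻¹ = 1 enters).  For m ≥ 0 the path counts form a
-- lower unitriangular array L, so T Q = L · diag(d_k); multiplying by the lower unitriangular inverse P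
-- of L gives P T Q = diag(d_0, …, d_n), and d_j divides d_k for j ≤ k.

open import Defs
open import Level using (Level)
open import Algebra.Bundles using (CommutativeRing)
open import Data.Nat using (ℕ; suc)
open import Algebra.Bundles using (RawRing)
open import Data.Nat as ℕ using (zero; _∸_; _<_; _≤_; z≤n; s≤s)
import Data.Nat.Properties as ℕP
open import Data.Integer as ℤ using (ℤ; +_; -[1+_]; _⊖_)
import Data.Integer.Properties as ℤP
open import Data.Sign as Sign using (Sign)
open import Data.Fin as Fin using (Fin; zero; suc; toℕ; punchIn; inject₁)
import Data.Fin.Properties as FinP
open import Data.Maybe using (Maybe; just; nothing)
open import Data.Product using (_,_)
open import Data.Empty using (⊥-elim)
open import Relation.Nullary using (¬_; yes; no)
import Relation.Binary.PropositionalEquality as Eq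

module IntegerRingSolver {c ℓ : Level} (R : CommutativeRing c ℓ) where
  open CommutativeRing R
  open import Relation.Binary.Reasoning.Setoid setoid
  import Algebra.Solver.Ring.AlmostCommutativeRing as ACR
  open import Algebra.Properties.Semiring.Mult.TCOptimised semiring using (_×_; ×-homo-+; ×1-homo-*)
  open import Algebra.Properties.Ring ring using (-1*x≈-x; -0#≈0#; -‿involutive)
  open import Algebra.Properties.AbelianGroup +-abelianGroup using (⁻¹-∙-comm)
  open import Algebra.Properties.CommutativeSemigroup *-commutativeSemigroup using (interchange)

  ⟦_⟧ℤ : ℤ → Carrier
  ⟦ + n ⟧ℤ = n × 1#
  ⟦ -[1+ n ] ⟧ℤ = - (suc n × 1#)

  private
    ×-suc : ∀ n → suc n × 1# ≈ 1# + n × 1#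
    ×-suc n = ×-homo-+ 1# 1 n

    sub-suc : ∀ x y → (1# + x) - (1# + y) ≈ x - y
    sub-suc x y = begin
      (1# + x) - (1# + y)    ≈⟨ +-congˡ (⁻¹-∙-comm 1# y) ⟨
      (1# + x) + (- 1# - y)  ≈⟨ +-congʳ (+-comm 1# x) ⟩
      (x + 1#) + (- 1# - y)  ≈⟨ +-assoc x 1# _ ⟩
      x + (1# + (- 1# - y))  ≈⟨ +-congˡ (+-assoc 1# (- 1#) (- y)) ⟨
      x + ((1# - 1#) - y)    ≈⟨ +-congˡ (+-congʳ (-‿inverseʳ 1#)) ⟩
      x + (0# - y)           ≈⟨ +-congˡ (+-identityˡ (- y)) ⟩
      x - y                  ∎

  ⊖-homo : ∀ m n → ⟦ m ⊖ n ⟧ℤ ≈ m × 1# - n × 1#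
  ⊖-homo m zero = trans (sym (+-identityʳ _)) (+-congˡ (sym -0#≈0#))
  ⊖-homo zero (suc n) = sym (+-identityˡ _)
  ⊖-homo (suc m) (suc n) = begin
    ⟦ suc m ⊖ suc n ⟧ℤ              ≡⟨ Eq.cong ⟦_⟧ℤ (ℤP.[1+m]⊖[1+n]≡m⊖n m n) ⟩
    ⟦ m ⊖ n ⟧ℤ                      ≈⟨ ⊖-homo m n ⟩
    m × 1# - n × 1#                 ≈⟨ sub-suc _ _ ⟨
    (1# + m × 1#) - (1# + n × 1#)   ≈⟨ +-cong (×-suc m) (-‿cong (×-suc n)) ⟨
    suc m × 1# - suc n × 1#         ∎

  +-homo : ∀ i j → ⟦ i ℤ.+ j ⟧ℤ ≈ ⟦ i ⟧ℤ + ⟦ j ⟧ℤ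
  +-homo -[1+ m ] -[1+ n ] = begin
    - (suc (suc (m ℕ.+ n)) × 1#)       ≈⟨ -‿cong (×-suc (suc (m ℕ.+ n))) ⟩
    - (1# + suc (m ℕ.+ n) × 1#)        ≈⟨ -‿cong (+-congˡ (×-homo-+ 1# (suc m) n)) ⟩
    - (1# + (suc m × 1# + n × 1#))     ≈⟨ -‿cong (+-assoc 1# _ _) ⟨
    - ((1# + suc m × 1#) + n × 1#)     ≈⟨ -‿cong (+-congʳ (+-comm 1# _)) ⟩
    - ((suc m × 1# + 1#) + n × 1#)     ≈⟨ -‿cong (+-assoc _ 1# _) ⟩
    - (suc m × 1# + (1# + n × 1#))     ≈⟨ -‿cong (+-congˡ (×-suc n)) ⟨
    - (suc m × 1# + suc n × 1#)        ≈⟨ ⁻¹-∙-comm _ _ ⟨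
    - (suc m × 1#) + - (suc n × 1#)    ∎
  +-homo -[1+ m ] (+ n) = trans (⊖-homo n (suc m)) (+-comm _ _)
  +-homo (+ m) -[1+ n ] = ⊖-homo m (suc n)
  +-homo (+ m) (+ n) = ×-homo-+ 1# m n

  neg-homo : ∀ i → ⟦ ℤ.- i ⟧ℤ ≈ - ⟦ i ⟧ℤ
  neg-homo (+ zero) = sym -0#≈0#
  neg-homo (+ suc n) = refl
  neg-homo -[1+ n ] = sym (-‿involutive _)

  -- multiplication is computed through signs and absolute values
  private
    ⟦_⟧ₛ : Sign → Carrier
    ⟦ Sign.+ ⟧ₛ = 1#
    ⟦ Sign.- ⟧ₛ = - 1#

    ◃-homo : ∀ s n → ⟦ s ℤ.◃ n ⟧ℤ ≈ ⟦ s ⟧ₛ * (n × 1#)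
    ◃-homo s zero = sym (zeroʳ _)
    ◃-homo Sign.+ (suc n) = sym (*-identityˡ _)
    ◃-homo Sign.- (suc n) = sym (-1*x≈-x _)

    sign-abs : ∀ i → ⟦ i ⟧ℤ ≈ ⟦ ℤ.sign i ⟧ₛ * (ℤ.∣ i ∣ × 1#)
    sign-abs (+ n) = sym (*-identityˡ _)
    sign-abs -[1+ n ] = sym (-1*x≈-x _)

    sign-homo : ∀ s t → ⟦ s Sign.* t ⟧ₛ ≈ ⟦ s ⟧ₛ * ⟦ t ⟧ₛ
    sign-homo Sign.- Sign.- = sym (trans (-1*x≈-x (- 1#)) (-‿involutive 1#))
    sign-homo Sign.- Sign.+ = sym (*-identityʳ _)
    sign-homo Sign.+ t = sym (*-identityˡ _)

  *-homo : ∀ i j → ⟦ i ℤ.* j ⟧ℤ ≈ ⟦ i ⟧ℤ * ⟦ j ⟧ℤ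
  *-homo i j = begin
    ⟦ (ℤ.sign i Sign.* ℤ.sign j) ℤ.◃ (ℤ.∣ i ∣ ℕ.* ℤ.∣ j ∣) ⟧ℤ
      ≈⟨ ◃-homo (ℤ.sign i Sign.* ℤ.sign j) (ℤ.∣ i ∣ ℕ.* ℤ.∣ j ∣) ⟩
    ⟦ ℤ.sign i Sign.* ℤ.sign j ⟧ₛ * ((ℤ.∣ i ∣ ℕ.* ℤ.∣ j ∣) × 1#)
      ≈⟨ *-cong (sign-homo (ℤ.sign i) (ℤ.sign j)) (×1-homo-* ℤ.∣ i ∣ ℤ.∣ j ∣) ⟩
    (⟦ ℤ.sign i ⟧ₛ * ⟦ ℤ.sign j ⟧ₛ) * ((ℤ.∣ i ∣ × 1#) * (ℤ.∣ j ∣ × 1#))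
      ≈⟨ interchange _ _ _ _ ⟩
    (⟦ ℤ.sign i ⟧ₛ * (ℤ.∣ i ∣ × 1#)) * (⟦ ℤ.sign j ⟧ₛ * (ℤ.∣ j ∣ × 1#))
      ≈⟨ *-cong (sign-abs i) (sign-abs j) ⟨
    ⟦ i ⟧ℤ * ⟦ j ⟧ℤ ∎

  ℤ-rawRing : RawRing _ _
  ℤ-rawRing = record { Carrier = ℤ ; _≈_ = Eq._≡_ ; _+_ = ℤ._+_ ; _*_ = ℤ._*_
                     ; -_ = ℤ.-_ ; 0# = + 0 ; 1# = + 1 }

  ℤ⟶R : ℤ-rawRing ACR.-Raw-AlmostCommutative⟶ ACR.fromCommutativeRing R
  ℤ⟶R = record { ⟦_⟧ = ⟦_⟧ℤ ; +-homo = +-homo ; *-homo = *-homo ; -‿homo = neg-homo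
               ; 0-homo = refl ; 1-homo = refl }

  ℤ-equal? : ∀ i j → Maybe (⟦ i ⟧ℤ ≈ ⟦ j ⟧ℤ)
  ℤ-equal? i j with i ℤ.≟ j
  ... | yes Eq.refl = just refl
  ... | no _ = nothing

  open import Algebra.Solver.Ring ℤ-rawRing (ACR.fromCommutativeRing R) ℤ⟶R ℤ-equal? public

module Kronecker {c ℓ : Level} (R : CommutativeRing c ℓ) where
  open CommutativeRing R hiding (zero)

  δ : ℕ → ℕ → Carrier
  δ zero zero = 1#
  δ zero (suc _) = 0#
  δ (suc _) zero = 0#
  δ (suc a) (suc b) = δ a b

  δ-diag : ∀ a → δ a a ≈ 1#
  δ-diag zero = refl
  δ-diag (suc a) = δ-diag a

  δ-off : ∀ a b → ¬ a Eq.≡ b → δ a b ≈ 0#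
  δ-off zero zero a≢b = ⊥-elim (a≢b Eq.refl)
  δ-off zero (suc b) _ = refl
  δ-off (suc a) zero _ = refl
  δ-off (suc a) (suc b) a≢b = δ-off a b (λ a≡b → a≢b (Eq.cong suc a≡b))

  δ-below : ∀ a b → a < b → δ a b ≈ 0#
  δ-below a b a<b = δ-off a b (ℕP.<⇒≢ a<b)

  δ-transfer : ∀ (f : ℕ → Carrier) a b → f a * δ a b ≈ f b * δ a b
  δ-transfer f zero zero = refl
  δ-transfer f zero (suc b) = trans (zeroʳ _) (sym (zeroʳ _))
  δ-transfer f (suc a) zero = trans (zeroʳ _) (sym (zeroʳ _))
  δ-transfer f (suc a) (suc b) = δ-transfer (λ x → f (suc x)) a b

module LatticePaths {c ℓ : Level} (R : CommutativeRing c ℓ) (e s : ℕ → CommutativeRing.Carrier R) where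
  open CommutativeRing R hiding (zero)
  open WithRing R using (schroeder)
  open Kronecker R
  open import Relation.Binary.Reasoning.Setoid setoid
  open import Algebra.Properties.CommutativeSemigroup +-commutativeSemigroup
    using () renaming (interchange to +-interchange)
  open import Algebra.Properties.CommutativeSemigroup *-commutativeSemigroup
    using () renaming (x∙yz≈y∙xz to *-leftComm)

  -- A grid assigns a weight to each pair (starting height, final height) of a set of paths.
  -- Steps have weights: NE ↦ 1, E at height h ↦ e h, SE from height h+1 ↦ s h.
  Grid : Set c
  Grid = ℕ → ℕ → Carrier

  infix 4 _≈₂_
  _≈₂_ : Grid → Grid → Set ℓ
  F ≈₂ G = ∀ h k → F h k ≈ G h k

  infixl 6 _⊞_
  _⊞_ : Grid → Grid → Grid
  (F ⊞ G) h k = F h k + G h k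

  -- Prepending a first step to the paths of a grid: an SE step (firstSE), an NE or SE step
  -- (firstSlope), or an E step (firstE).
  firstSE : Grid → Grid
  firstSE F zero k = 0#
  firstSE F (suc h) k = s h * F h k

  firstSlope : Grid → Grid
  firstSlope F h k = F (suc h) k + firstSE F h k

  firstE : Grid → Grid
  firstE F h k = e h * F h k

  -- Appending a last step: an NE step (lastNE), an NE or SE step (lastSlope), or an E step (lastE).
  lastNE : Grid → Grid
  lastNE F h zero = 0#
  lastNE F h (suc k) = F h k

  lastSlope : Grid → Grid
  lastSlope F h k = lastNE F h k + s k * F h (suc k)

  lastE : Grid → Grid
  lastE F h k = e k * F h k

  -- walks n h k: total weight of the paths of half-length n (an E step counts twice) from height h to height k,
  -- defined by decomposing with respect to the first step.
  walks : ℕ → Grid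
  walks zero = δ
  walks (suc zero) = firstSlope δ
  walks (suc (suc n)) = firstSlope (walks (suc n)) ⊞ firstE (walks n)

  firstSlope-cong : ∀ {F G} → F ≈₂ G → firstSlope F ≈₂ firstSlope G
  firstSlope-cong {F} {G} F≈G h k = +-cong (F≈G (suc h) k) (firstSE-cong h)
    where
    firstSE-cong : ∀ h → firstSE F h k ≈ firstSE G h k
    firstSE-cong zero = refl
    firstSE-cong (suc h) = *-congˡ (F≈G h k)

  firstE-cong : ∀ {F G} → F ≈₂ G → firstE F ≈₂ firstE G
  firstE-cong F≈G h k = *-congˡ (F≈G h k)

  lastE-cong : ∀ {F G} → F ≈₂ G → lastE F ≈₂ lastE G
  lastE-cong F≈G h k = *-congˡ (F≈G h k)

  firstSlope-+ : ∀ F G → firstSlope (F ⊞ G) ≈₂ firstSlope F ⊞ firstSlope G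
  firstSlope-+ F G h k = trans (+-congˡ (firstSE-+ h)) (+-interchange _ _ _ _)
    where
    firstSE-+ : ∀ h → firstSE (F ⊞ G) h k ≈ firstSE F h k + firstSE G h k
    firstSE-+ zero = sym (+-identityˡ 0#)
    firstSE-+ (suc h) = distribˡ (s h) _ _

  firstE-+ : ∀ F G → firstE (F ⊞ G) ≈₂ firstE F ⊞ firstE G
  firstE-+ F G h k = distribˡ (e h) _ _

  lastSlope-+ : ∀ F G → lastSlope (F ⊞ G) ≈₂ lastSlope F ⊞ lastSlope G
  lastSlope-+ F G h k = trans (+-cong (lastNE-+ k) (distribˡ (s k) _ _)) (+-interchange _ _ _ _)
    where
    lastNE-+ : ∀ k → lastNE (F ⊞ G) h k ≈ lastNE F h k + lastNE G h k
    lastNE-+ zero = sym (+-identityˡ 0#)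
    lastNE-+ (suc k) = refl

  lastE-+ : ∀ F G → lastE (F ⊞ G) ≈₂ lastE F ⊞ lastE G
  lastE-+ F G h k = distribˡ (e k) _ _

  firstSlope-lastSlope : ∀ F → firstSlope (lastSlope F) ≈₂ lastSlope (firstSlope F)
  firstSlope-lastSlope F h k = begin
    lastSlope F (suc h) k + firstSE (lastSlope F) h k
      ≈⟨ +-congˡ (firstSE-lastSlope h k) ⟩
    (lastNE F (suc h) k + s k * F (suc h) (suc k)) + (lastNE (firstSE F) h k + s k * firstSE F h (suc k))
      ≈⟨ +-interchange _ _ _ _ ⟩
    (lastNE F (suc h) k + lastNE (firstSE F) h k) + (s k * F (suc h) (suc k) + s k * firstSE F h (suc k))
      ≈⟨ +-cong (lastNE-firstSlope k) (sym (distribˡ (s k) _ _)) ⟩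
    lastSlope (firstSlope F) h k ∎
    where
    firstSE-lastSlope : ∀ h k → firstSE (lastSlope F) h k ≈ lastSlope (firstSE F) h k
    firstSE-lastSlope zero zero = sym (trans (+-identityˡ _) (zeroʳ _))
    firstSE-lastSlope zero (suc k) = sym (trans (+-identityˡ _) (zeroʳ _))
    firstSE-lastSlope (suc h) zero = trans (distribˡ _ _ _) (+-cong (zeroʳ _) (*-leftComm _ _ _))
    firstSE-lastSlope (suc h) (suc k) = trans (distribˡ _ _ _) (+-congˡ (*-leftComm _ _ _))
    lastNE-firstSlope : ∀ k → lastNE F (suc h) k + lastNE (firstSE F) h k ≈ lastNE (firstSlope F) h k
    lastNE-firstSlope zero = +-identityˡ 0#
    lastNE-firstSlope (suc k) = refl

  firstSlope-lastE : ∀ F → firstSlope (lastE F) ≈₂ lastE (firstSlope F)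
  firstSlope-lastE F h k = trans (+-congˡ (firstSE-lastE h)) (sym (distribˡ (e k) _ _))
    where
    firstSE-lastE : ∀ h → firstSE (lastE F) h k ≈ e k * firstSE F h k
    firstSE-lastE zero = sym (zeroʳ (e k))
    firstSE-lastE (suc h) = *-leftComm _ _ _

  firstE-lastSlope : ∀ F → firstE (lastSlope F) ≈₂ lastSlope (firstE F)
  firstE-lastSlope F h k = trans (distribˡ (e h) _ _) (+-cong (firstE-lastNE k) (*-leftComm _ _ _))
    where
    firstE-lastNE : ∀ k → e h * lastNE F h k ≈ lastNE (firstE F) h k
    firstE-lastNE zero = zeroʳ (e h)
    firstE-lastNE (suc k) = refl

  firstE-lastE : ∀ F → firstE (lastE F) ≈₂ lastE (firstE F)
  firstE-lastE F h k = *-leftComm _ _ _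

  firstSlope-δ : firstSlope δ ≈₂ lastSlope δ
  firstSlope-δ zero zero = trans (+-identityʳ _) (sym (trans (+-identityˡ _) (zeroʳ _)))
  firstSlope-δ zero (suc k) = trans (+-identityʳ _) (sym (trans (+-congˡ (zeroʳ _)) (+-identityʳ _)))
  firstSlope-δ (suc h) zero = begin
    0# + s h * δ h zero        ≈⟨ +-identityˡ _ ⟩
    s h * δ h zero             ≈⟨ δ-transfer s h zero ⟩
    s zero * δ h zero          ≈⟨ +-identityˡ _ ⟨
    0# + s zero * δ h zero     ∎
  firstSlope-δ (suc h) (suc k) = +-congˡ (δ-transfer s h (suc k))

  firstE-δ : firstE δ ≈₂ lastE δ
  firstE-δ = δ-transfer e

  -- One step of the induction turning first-step into last-step decompositions.
  slide : ∀ {A B X Y P Q} → A ≈₂ lastSlope X ⊞ lastE Y → B ≈₂ lastSlope P ⊞ lastE Q →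
          firstSlope A ⊞ firstE B ≈₂ lastSlope (firstSlope X ⊞ firstE P) ⊞ lastE (firstSlope Y ⊞ firstE Q)
  slide {A} {B} {X} {Y} {P} {Q} A≈ B≈ h k = begin
    firstSlope A h k + firstE B h k
      ≈⟨ +-cong (firstSlope-cong A≈ h k) (firstE-cong B≈ h k) ⟩
    firstSlope (lastSlope X ⊞ lastE Y) h k + firstE (lastSlope P ⊞ lastE Q) h k
      ≈⟨ +-cong (firstSlope-+ (lastSlope X) (lastE Y) h k) (firstE-+ (lastSlope P) (lastE Q) h k) ⟩
    (firstSlope (lastSlope X) h k + firstSlope (lastE Y) h k) + (firstE (lastSlope P) h k + firstE (lastE Q) h k)
      ≈⟨ +-cong (+-cong (firstSlope-lastSlope X h k) (firstSlope-lastE Y h k))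
                (+-cong (firstE-lastSlope P h k) (firstE-lastE Q h k)) ⟩
    (lastSlope (firstSlope X) h k + lastE (firstSlope Y) h k) + (lastSlope (firstE P) h k + lastE (firstE Q) h k)
      ≈⟨ +-interchange _ _ _ _ ⟩
    (lastSlope (firstSlope X) h k + lastSlope (firstE P) h k) + (lastE (firstSlope Y) h k + lastE (firstE Q) h k)
      ≈⟨ +-cong (lastSlope-+ (firstSlope X) (firstE P) h k) (lastE-+ (firstSlope Y) (firstE Q) h k) ⟨
    lastSlope (firstSlope X ⊞ firstE P) h k + lastE (firstSlope Y ⊞ firstE Q) h k ∎

  -- the grid of no paths, the walks of half-length -1
  𝟘 : Grid
  𝟘 h k = 0#

  walks-last : ∀ n → walks (suc (suc n)) ≈₂ lastSlope (walks (suc n)) ⊞ lastE (walks n)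
  walks-last zero h k = begin
    firstSlope (firstSlope δ) h k + firstE δ h k
      ≈⟨ +-cong (firstSlope-cong firstSlope-δ h k) (firstE-δ h k) ⟩
    firstSlope (lastSlope δ) h k + lastE δ h k
      ≈⟨ +-congʳ (firstSlope-lastSlope δ h k) ⟩
    lastSlope (firstSlope δ) h k + lastE δ h k ∎
  walks-last (suc zero) h k = begin
    walks 3 h k
      ≈⟨ slide {X = walks 1} {walks 0} {walks 0} {𝟘} (walks-last zero) walks₁ h k ⟩
    lastSlope (walks 2) h k + lastE (firstSlope δ ⊞ firstE 𝟘) h k
      ≈⟨ +-congˡ (lastE-cong {firstSlope δ ⊞ firstE 𝟘} {walks 1} (λ h′ k′ → trans (+-congˡ (zeroʳ (e h′))) (+-identityʳ _))
                            h k) ⟩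
    lastSlope (walks 2) h k + lastE (walks 1) h k ∎
    where
    walks₁ : walks 1 ≈₂ lastSlope (walks 0) ⊞ lastE 𝟘
    walks₁ h k = trans (firstSlope-δ h k) (sym (trans (+-congˡ (zeroʳ _)) (+-identityʳ _)))
  walks-last (suc (suc n)) = slide (walks-last (suc n)) (walks-last n)

  VanishesAbove : ℕ → Grid → Set ℓ
  VanishesAbove m F = ∀ h k → h ℕ.+ m < k → F h k ≈ 0#

  firstSlope-vanishes : ∀ {F} m → VanishesAbove m F → VanishesAbove (suc m) (firstSlope F)
  firstSlope-vanishes {F} m F-vanishes h k h+m+1<k =
    trans (+-cong (F-vanishes (suc h) k (Eq.subst (_< k) (ℕP.+-suc h m) h+m+1<k)) (firstSE-vanishes h h+m+1<k))
          (+-identityʳ 0#)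
    where
    firstSE-vanishes : ∀ h → h ℕ.+ suc m < k → firstSE F h k ≈ 0#
    firstSE-vanishes zero _ = refl
    firstSE-vanishes (suc h) h+m+2<k =
      trans (*-congˡ (F-vanishes h k (ℕP.<-trans (ℕP.+-monoʳ-< h (ℕP.n<1+n m)) (ℕP.<-trans (ℕP.n<1+n _) h+m+2<k))))
            (zeroʳ _)

  walks-vanish : ∀ n → VanishesAbove n (walks n)
  walks-vanish zero h k h<k = δ-below h k (Eq.subst (_< k) (ℕP.+-identityʳ h) h<k)
  walks-vanish (suc zero) = firstSlope-vanishes 0 (walks-vanish 0)
  walks-vanish (suc (suc n)) h k h+n+2<k =
    trans (+-cong (firstSlope-vanishes (suc n) (walks-vanish (suc n)) h k h+n+2<k)
                  (trans (*-congˡ (walks-vanish n h k h+n<k)) (zeroʳ (e h))))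
          (+-identityʳ 0#)
    where
    h+n<k : h ℕ.+ n < k
    h+n<k = ℕP.≤-<-trans (ℕP.+-monoʳ-≤ h (ℕP.n≤1+n _)) (ℕP.<-trans (ℕP.+-monoʳ-< h (ℕP.n<1+n _)) h+n+2<k)

  firstSlope-top : ∀ {F} m → VanishesAbove m F → (∀ h → F h (h ℕ.+ m) ≈ 1#) →
                   ∀ h → firstSlope F h (h ℕ.+ suc m) ≈ 1#
  firstSlope-top {F} m F-vanishes F-top h =
    trans (+-cong (trans (reflexive (Eq.cong (F (suc h)) (ℕP.+-suc h m))) (F-top (suc h))) (firstSE-vanishes h))
          (+-identityʳ 1#)
    where
    firstSE-vanishes : ∀ h → firstSE F h (h ℕ.+ suc m) ≈ 0#
    firstSE-vanishes zero = refl
    firstSE-vanishes (suc h) =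
      trans (*-congˡ (F-vanishes h _ (ℕP.<-trans (ℕP.+-monoʳ-< h (ℕP.n<1+n m)) (ℕP.n<1+n _)))) (zeroʳ _)

  -- The steepest path, made of NE steps only, has weight one.
  walks-top : ∀ n h → walks n h (h ℕ.+ n) ≈ 1#
  walks-top zero h = trans (reflexive (Eq.cong (δ h) (ℕP.+-identityʳ h))) (δ-diag h)
  walks-top (suc zero) = firstSlope-top 0 (walks-vanish 0) (walks-top 0)
  walks-top (suc (suc n)) h =
    trans (+-cong (firstSlope-top (suc n) (walks-vanish (suc n)) (walks-top (suc n)) h)
                  (trans (*-congˡ (walks-vanish n h _ h+n<h+n+2)) (zeroʳ (e h))))
          (+-identityʳ 1#)
    where
    h+n<h+n+2 : h ℕ.+ n < h ℕ.+ suc (suc n)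
    h+n<h+n+2 = ℕP.+-monoʳ-< h (ℕP.<-trans (ℕP.n<1+n n) (ℕP.n<1+n _))

  schroeder-walks : ∀ n h → schroeder e s n h ≈ walks n h 0
  schroeder-walks zero zero = refl
  schroeder-walks zero (suc h) = refl
  schroeder-walks (suc zero) zero = sym (+-identityʳ _)
  schroeder-walks (suc zero) (suc h) = +-cong (schroeder-walks 0 (suc (suc h))) (*-congˡ (schroeder-walks 0 h))
  schroeder-walks (suc (suc n)) zero =
    +-cong (trans (schroeder-walks (suc n) 1) (sym (+-identityʳ _))) (*-congˡ (schroeder-walks n 0))
  schroeder-walks (suc (suc n)) (suc h) =
    +-cong (+-cong (schroeder-walks (suc n) (suc (suc h))) (*-congˡ (schroeder-walks (suc n) h)))
           (*-congˡ (schroeder-walks n (suc h)))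

  fromOrigin : ℕ → ℕ → Carrier
  fromOrigin t k = walks (t ∸ k) 0 k

  fromOrigin-cong : ∀ {u v} k → u Eq.≡ v → fromOrigin u k ≈ fromOrigin v k
  fromOrigin-cong k u≡v = reflexive (Eq.cong (λ u → fromOrigin u k) u≡v)

  fromOrigin-within : ∀ a k r → fromOrigin (a ℕ.+ (k ℕ.+ r)) k ≈ walks (a ℕ.+ r) 0 k
  fromOrigin-within a k r = reflexive (Eq.cong (λ n → walks n 0 k) length≡)
    where
    length≡ : (a ℕ.+ (k ℕ.+ r)) ∸ k Eq.≡ a ℕ.+ r
    length≡ = Eq.trans (ℕP.+-∸-assoc a (ℕP.m≤m+n k r)) (Eq.cong (a ℕ.+_) (ℕP.m+n∸m≡n k r))

  fromOrigin-top : ∀ k → fromOrigin (k ℕ.+ k) k ≈ 1#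
  fromOrigin-top k = trans (reflexive (Eq.cong (λ n → walks n 0 k) (ℕP.m+n∸n≡m k k))) (walks-top k 0)

  fromOrigin-vanish : ∀ t k → t < k ℕ.+ k → fromOrigin t k ≈ 0#
  fromOrigin-vanish t (suc k) t<2k = walks-vanish (t ∸ suc k) 0 (suc k) (ℕP.m<n+o⇒m∸n<o t (suc k) t<2k)

  -- the contribution of a last NE step arriving at height k
  below : ℕ → ℕ → Carrier
  below t zero = 0#
  below t (suc k) = fromOrigin t k

  data Position (t k : ℕ) : Set where
    within    : ∀ r → t Eq.≡ k ℕ.+ r → Position t k
    justAbove : k Eq.≡ suc t → Position t k
    farAbove  : ∀ r → k Eq.≡ suc (suc (t ℕ.+ r)) → Position t k

  position : ∀ t k → Position t k
  position t zero = within t Eq.refl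
  position zero (suc zero) = justAbove Eq.refl
  position zero (suc (suc k)) = farAbove k Eq.refl
  position (suc t) (suc k) with position t k
  ... | within r eq = within r (Eq.cong suc eq)
  ... | justAbove eq = justAbove (Eq.cong suc eq)
  ... | farAbove r eq = farAbove r (Eq.cong suc eq)

  -- Above height t only the last NE step can contribute.
  fromOrigin-last-beyond : ∀ t k → t < k → fromOrigin (suc (suc t)) k ≈ below t k →
    fromOrigin (suc (suc t)) k ≈ (below t k + s k * fromOrigin (suc (suc t)) (suc k)) + e k * fromOrigin t k
  fromOrigin-last-beyond t k t<k ≈below = begin
    fromOrigin (suc (suc t)) k                 ≈⟨ ≈below ⟩
    below t k                                  ≈⟨ +-identityʳ _ ⟨
    below t k + 0#                             ≈⟨ +-identityʳ _ ⟨
    (below t k + 0#) + 0#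
      ≈⟨ +-cong (+-congˡ (trans (*-congˡ (fromOrigin-vanish _ (suc k) 2+t<2k+2)) (zeroʳ _)))
                (trans (*-congˡ (fromOrigin-vanish t k (ℕP.≤-trans t<k (ℕP.m≤m+n k k)))) (zeroʳ _)) ⟨
    (below t k + s k * fromOrigin (suc (suc t)) (suc k)) + e k * fromOrigin t k ∎
    where
    2+t<2k+2 : suc (suc t) < suc k ℕ.+ suc k
    2+t<2k+2 = ℕP.≤-trans (s≤s (s≤s t<k)) (s≤s (ℕP.m≤n+m (suc k) k))

  fromOrigin-last : ∀ t k →
    fromOrigin (suc (suc t)) k ≈ (below t k + s k * fromOrigin (suc (suc t)) (suc k)) + e k * fromOrigin t k
  fromOrigin-last t k with position t k
  ... | within r Eq.refl = begin
    fromOrigin (2 ℕ.+ (k ℕ.+ r)) k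
      ≈⟨ fromOrigin-within 2 k r ⟩
    walks (2 ℕ.+ r) 0 k
      ≈⟨ walks-last r 0 k ⟩
    (lastNE (walks (suc r)) 0 k + s k * walks (suc r) 0 (suc k)) + e k * walks r 0 k
      ≈⟨ +-cong (+-cong (lastNE-below k) (*-congˡ (fromOrigin-within 1 (suc k) r)))
                (*-congˡ (fromOrigin-within 0 k r)) ⟨
    (below (k ℕ.+ r) k + s k * fromOrigin (2 ℕ.+ (k ℕ.+ r)) (suc k)) + e k * fromOrigin (k ℕ.+ r) k ∎
    where
    lastNE-below : ∀ k → below (k ℕ.+ r) k ≈ lastNE (walks (suc r)) 0 k
    lastNE-below zero = refl
    lastNE-below (suc k) = fromOrigin-within 1 k r
  ... | justAbove Eq.refl = fromOrigin-last-beyond t (suc t) (ℕP.n<1+n t) (begin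
    walks (suc t ∸ t) 0 (suc t)        ≡⟨ Eq.cong (λ n → walks n 0 (suc t)) (ℕP.m+n∸n≡m 1 t) ⟩
    δ 0 t + 0#                         ≈⟨ +-identityʳ _ ⟩
    walks 0 0 t                        ≡⟨ Eq.cong (λ n → walks n 0 t) (ℕP.n∸n≡0 t) ⟨
    fromOrigin t t                     ∎)
  ... | farAbove r Eq.refl = fromOrigin-last-beyond t k t<k
    (trans (reflexive (Eq.cong (λ n → walks n 0 k) (ℕP.m≤n⇒m∸n≡0 (ℕP.m≤m+n t r))))
           (sym (fromOrigin-vanish t (suc (t ℕ.+ r)) (ℕP.≤-trans (s≤s (ℕP.m≤m+n t r)) (ℕP.m≤m+n _ _)))))
    where
    t<k : t < k
    t<k = s≤s (ℕP.m≤n⇒m≤1+n (ℕP.m≤m+n t r))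

module FiniteSums {c ℓ : Level} (R : CommutativeRing c ℓ) where
  open CommutativeRing R hiding (zero)
  open WithRing R using (Σ[_]; Matrix; _⊗_; _≋_)
  open import Algebra.Properties.Semiring.Sum semiring
    using (sum; sum-cong-≋; sum-replicate-zero; sum-init-last; ∑-comm; ∑-distrib-+; *-distribˡ-sum; *-distribʳ-sum)
  open import Algebra.Properties.Ring ring using (-1*x≈-x)
  open import Relation.Binary.Reasoning.Setoid setoid

  Σ≡sum : ∀ n (f : Fin n → Carrier) → Σ[ n ] f Eq.≡ sum f
  Σ≡sum zero f = Eq.refl
  Σ≡sum (suc n) f = Eq.cong (λ x → f zero + x) (Σ≡sum n (λ j → f (suc j)))

  ∑-zero : ∀ n {f : Fin n → Carrier} → (∀ j → f j ≈ 0#) → sum f ≈ 0#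
  ∑-zero n {f} f≈0 = trans (sum-cong-≋ {n} {f} f≈0) (sum-replicate-zero n)

  ∑-sub : ∀ n (f g : Fin n → Carrier) → sum (λ j → f j - g j) ≈ sum f - sum g
  ∑-sub n f g = begin
    sum (λ j → f j - g j)             ≈⟨ ∑-distrib-+ f (λ j → - g j) ⟩
    sum f + sum (λ j → - g j)         ≈⟨ +-congˡ (sum-cong-≋ (λ j → -1*x≈-x (g j))) ⟨
    sum f + sum (λ j → - 1# * g j)    ≈⟨ +-congˡ (*-distribˡ-sum (- 1#) g) ⟨
    sum f + - 1# * sum g              ≈⟨ +-congˡ (-1*x≈-x (sum g)) ⟩
    sum f - sum g                     ∎

  sumTo : ℕ → (ℕ → Carrier) → Carrier
  sumTo N f = sum {N} (λ j → f (toℕ j))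

  sumTo-cong : ∀ N {f g : ℕ → Carrier} → (∀ j → f j ≈ g j) → sumTo N f ≈ sumTo N g
  sumTo-cong N {f} {g} f≈g = sum-cong-≋ {N} {λ j → f (toℕ j)} {λ j → g (toℕ j)} (λ j → f≈g (toℕ j))

  sumTo-zero : ∀ N {f : ℕ → Carrier} → (∀ j → f j ≈ 0#) → sumTo N f ≈ 0#
  sumTo-zero N {f} f≈0 = ∑-zero N {λ j → f (toℕ j)} (λ j → f≈0 (toℕ j))

  sumTo-sub : ∀ N (f g : ℕ → Carrier) → sumTo N (λ j → f j - g j) ≈ sumTo N f - sumTo N g
  sumTo-sub N f g = ∑-sub N (λ j → f (toℕ j)) (λ j → g (toℕ j))

  sumTo-scaleˡ : ∀ N a (f : ℕ → Carrier) → sumTo N (λ j → a * f j) ≈ a * sumTo N f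
  sumTo-scaleˡ N a f = sym (*-distribˡ-sum {N} a (λ j → f (toℕ j)))

  sumTo-scaleʳ : ∀ N a (f : ℕ → Carrier) → sumTo N (λ j → f j * a) ≈ sumTo N f * a
  sumTo-scaleʳ N a f = sym (*-distribʳ-sum {N} a (λ j → f (toℕ j)))

  sumTo-last : ∀ n (f : ℕ → Carrier) → sumTo (suc n) f ≈ sumTo n f + f n
  sumTo-last n f = trans (sum-init-last (λ j → f (toℕ j)))
    (+-cong (sum-cong-≋ {n} {λ j → f (toℕ (inject₁ j))} (λ j → reflexive (Eq.cong f (FinP.toℕ-inject₁ j))))
            (reflexive (Eq.cong f (FinP.toℕ-fromℕ n))))

  Σ≈sum : ∀ n {f g : Fin n → Carrier} → (∀ j → f j ≈ g j) → Σ[ n ] f ≈ sum g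
  Σ≈sum n {f} f≈g = trans (reflexive (Σ≡sum n f)) (sum-cong-≋ f≈g)

  Σ-zero : ∀ n {f : Fin n → Carrier} → (∀ j → f j ≈ 0#) → Σ[ n ] f ≈ 0#
  Σ-zero n f≈0 = trans (Σ≈sum n f≈0) (sum-replicate-zero n)

  ⊗-assoc : ∀ {m n p q} (A : Matrix m n) (B : Matrix n p) (C : Matrix p q) → ((A ⊗ B) ⊗ C) ≋ (A ⊗ (B ⊗ C))
  ⊗-assoc {n = n} {p} A B C i k = begin
    ((A ⊗ B) ⊗ C) i k
      ≈⟨ Σ≈sum p (λ j → *-congʳ (Σ≈sum n (λ l → refl))) ⟩
    sum (λ j → sum (λ l → A i l * B l j) * C j k)
      ≈⟨ sum-cong-≋ (λ j → *-distribʳ-sum (C j k) (λ l → A i l * B l j)) ⟩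
    sum (λ j → sum (λ l → (A i l * B l j) * C j k))
      ≈⟨ sum-cong-≋ (λ j → sum-cong-≋ (λ l → *-assoc (A i l) (B l j) (C j k))) ⟩
    sum (λ j → sum (λ l → A i l * (B l j * C j k)))
      ≈⟨ ∑-comm (λ j l → A i l * (B l j * C j k)) ⟩
    sum (λ l → sum (λ j → A i l * (B l j * C j k)))
      ≈⟨ sum-cong-≋ (λ l → *-distribˡ-sum (A i l) (λ j → B l j * C j k)) ⟨
    sum (λ l → A i l * sum (λ j → B l j * C j k))
      ≈⟨ Σ≈sum n (λ l → *-congˡ (Σ≈sum p (λ j → refl))) ⟨
    (A ⊗ (B ⊗ C)) i k ∎

module Unitriangular {c ℓ : Level} (R : CommutativeRing c ℓ) where
  open CommutativeRing R hiding (zero)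
  open WithRing R using (Matrix; det)
  open FiniteSums R
  open Kronecker R
  open import Relation.Binary.Reasoning.Setoid setoid

  det-expand₀ : ∀ n (A : Matrix (suc n) (suc n)) →
    (∀ j → A zero (suc j) * det n (λ r c → A (suc r) (punchIn (suc j) c)) ≈ 0#) →
    det (suc n) A ≈ A zero zero * det n (λ r c → A (suc r) (suc c))
  det-expand₀ n A rest≈0 =
    trans (+-cong (*-identityˡ _) (Σ-zero n (λ j → trans (*-congˡ (rest≈0 j)) (zeroʳ _)))) (+-identityʳ _)

  mutual
    det-zeroColumn : ∀ n (A : Matrix (suc n) (suc n)) → (∀ r → A r zero ≈ 0#) → det (suc n) A ≈ 0#
    det-zeroColumn n A col≈0 =
      trans (det-expand₀ n A (λ j → trans (*-congˡ (minor-zeroColumn j A (λ r → col≈0 (suc r)))) (zeroʳ _)))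
            (trans (*-congʳ (col≈0 zero)) (zeroˡ _))

    minor-zeroColumn : ∀ {n} (j : Fin n) (A : Matrix (suc n) (suc n)) → (∀ r → A (suc r) zero ≈ 0#) →
                       det n (λ r c → A (suc r) (punchIn (suc j) c)) ≈ 0#
    minor-zeroColumn {suc n} j A col≈0 = det-zeroColumn n (λ r c → A (suc r) (punchIn (suc j) c)) col≈0

  det-upperUnitriangular : ∀ n (A : Matrix n n) → (∀ i → A i i ≈ 1#) →
                           (∀ i j → toℕ j < toℕ i → A i j ≈ 0#) → det n A ≈ 1#
  det-upperUnitriangular zero A diag≈1 lower≈0 = refl
  det-upperUnitriangular (suc n) A diag≈1 lower≈0 =
    trans (det-expand₀ n A (λ j → trans (*-congˡ (minor-zeroColumn j A firstColumn≈0)) (zeroʳ _)))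
          (trans (*-cong (diag≈1 zero) minor≈1) (*-identityˡ 1#))
    where
    firstColumn≈0 : ∀ r → A (suc r) zero ≈ 0#
    firstColumn≈0 r = lower≈0 (suc r) zero (s≤s z≤n)
    minor≈1 : det n (λ r c → A (suc r) (suc c)) ≈ 1#
    minor≈1 = det-upperUnitriangular n _ (λ i → diag≈1 (suc i)) (λ i j j<i → lower≈0 (suc i) (suc j) (s≤s j<i))

  det-lowerUnitriangular : ∀ n (A : Matrix n n) → (∀ i → A i i ≈ 1#) →
                           (∀ i j → toℕ i < toℕ j → A i j ≈ 0#) → det n A ≈ 1#
  det-lowerUnitriangular zero A diag≈1 upper≈0 = refl
  det-lowerUnitriangular (suc n) A diag≈1 upper≈0 =
    trans (det-expand₀ n A (λ j → trans (*-congʳ (upper≈0 zero (suc j) (s≤s z≤n))) (zeroˡ _)))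
          (trans (*-cong (diag≈1 zero) minor≈1) (*-identityˡ 1#))
    where
    minor≈1 : det n (λ r c → A (suc r) (suc c)) ≈ 1#
    minor≈1 = det-lowerUnitriangular n _ (λ i → diag≈1 (suc i)) (λ i j i<j → upper≈0 (suc i) (suc j) (s≤s i<j))

  -- Square arrays indexed by ℕ; a matrix of size N is read off their entries below N.
  Array : Set c
  Array = ℕ → ℕ → Carrier

  dropFirst : Array → Array
  dropFirst L a b = L (suc a) (suc b)

  -- A left inverse of the N×N lower unitriangular array L, obtained by clearing its first column.
  lowerInverse : ℕ → Array → Array
  lowerInverse zero L i k = 0#
  lowerInverse (suc N) L zero zero = 1#
  lowerInverse (suc N) L zero (suc k) = 0#
  lowerInverse (suc N) L (suc i) zero = - sumTo N (λ l → lowerInverse N (dropFirst L) i l * L (suc l) 0)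
  lowerInverse (suc N) L (suc i) (suc k) = lowerInverse N (dropFirst L) i k

  lowerInverse-upper : ∀ N L i k → i < k → lowerInverse N L i k ≈ 0#
  lowerInverse-upper zero L i k i<k = refl
  lowerInverse-upper (suc N) L zero (suc k) i<k = refl
  lowerInverse-upper (suc N) L (suc i) (suc k) (s≤s i<k) = lowerInverse-upper N (dropFirst L) i k i<k

  lowerInverse-diag : ∀ N L k → k < N → lowerInverse N L k k ≈ 1#
  lowerInverse-diag (suc N) L zero k<N = refl
  lowerInverse-diag (suc N) L (suc k) (s≤s k<N) = lowerInverse-diag N (dropFirst L) k k<N

  lowerInverse-left : ∀ N L → (∀ k → L k k ≈ 1#) → (∀ l k → l < k → L l k ≈ 0#) →
    ∀ i k → i < N → k < N → sumTo N (λ l → lowerInverse N L i l * L l k) ≈ δ i k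
  lowerInverse-left (suc N) L diag≈1 upper≈0 zero k i<N k<N = begin
    1# * L 0 k + sumTo N (λ l → 0# * L (suc l) k)   ≈⟨ +-cong (*-identityˡ _) (sumTo-zero N (λ l → zeroˡ (L (suc l) k))) ⟩
    L 0 k + 0#                                       ≈⟨ +-identityʳ _ ⟩
    L 0 k                                            ≈⟨ firstRow k ⟩
    δ 0 k                                            ∎
    where
    firstRow : ∀ k → L 0 k ≈ δ 0 k
    firstRow zero = diag≈1 0
    firstRow (suc k) = upper≈0 0 (suc k) (s≤s z≤n)
  lowerInverse-left (suc N) L diag≈1 upper≈0 (suc i) zero i<N k<N =
    trans (+-congʳ (trans (*-congˡ (diag≈1 0)) (*-identityʳ _))) (-‿inverseˡ _)
  lowerInverse-left (suc N) L diag≈1 upper≈0 (suc i) (suc k) (s≤s i<N) (s≤s k<N) =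
    trans (+-cong (trans (*-congˡ (upper≈0 0 (suc k) (s≤s z≤n))) (zeroʳ _))
                  (lowerInverse-left N (dropFirst L) (λ k → diag≈1 (suc k))
                                     (λ l k l<k → upper≈0 (suc l) (suc k) (s≤s l<k)) i k i<N k<N))
          (+-identityˡ _)

-- Pairing of the moments of a functional with coefficient sequences of polynomials of degree at most n:
-- ⟨ m ∣ p ⟩ = Σ_{j ≤ n} μ_{m-j} p_j  is the value of the functional on z^m p(1/z).
module Pairing {c ℓ : Level} (R : CommutativeRing c ℓ) (μ : ℤ → CommutativeRing.Carrier R) (n : ℕ) where
  open CommutativeRing R hiding (zero)
  open FiniteSums R
  open IntegerRingSolver R using (solve; _:=_; _:*_; _:-_)
  open import Relation.Binary.Reasoning.Setoid setoid

  Poly : Set c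
  Poly = ℕ → Carrier

  ⟨_∣_⟩ : ℤ → Poly → Carrier
  ⟨ m ∣ p ⟩ = sumTo (suc n) (λ j → μ (m ℤ.- + j) * p j)

  unit : Poly
  unit zero = 1#
  unit (suc j) = 0#

  shift : Poly → Poly
  shift p zero = 0#
  shift p (suc j) = p j

  pair-unit : ∀ m → ⟨ m ∣ unit ⟩ ≈ μ m
  pair-unit m = begin
    μ (m ℤ.- + 0) * 1# + sumTo n (λ j → μ (m ℤ.- + suc j) * 0#)
      ≈⟨ +-cong (*-identityʳ _) (sumTo-zero n (λ j → zeroʳ (μ (m ℤ.- + suc j)))) ⟩
    μ (m ℤ.- + 0) + 0#  ≈⟨ +-identityʳ _ ⟩
    μ (m ℤ.- + 0)       ≡⟨ Eq.cong μ (ℤP.+-identityʳ m) ⟩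
    μ m                 ∎

  pair-scale : ∀ m a p → ⟨ m ∣ (λ j → a * p j) ⟩ ≈ a * ⟨ m ∣ p ⟩
  pair-scale m a p = begin
    sumTo (suc n) (λ j → μ (m ℤ.- + j) * (a * p j))
      ≈⟨ sumTo-cong (suc n) (λ j → solve 3 (λ x y z → x :* (y :* z) := y :* (x :* z)) refl (μ (m ℤ.- + j)) a (p j)) ⟩
    sumTo (suc n) (λ j → a * (μ (m ℤ.- + j) * p j))
      ≈⟨ sumTo-scaleˡ (suc n) a (λ j → μ (m ℤ.- + j) * p j) ⟩
    a * ⟨ m ∣ p ⟩ ∎

  pair-combine : ∀ m a p q r → ⟨ m ∣ (λ j → (p j - a * q j) - r j) ⟩ ≈ (⟨ m ∣ p ⟩ - a * ⟨ m ∣ q ⟩) - ⟨ m ∣ r ⟩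
  pair-combine m a p q r = begin
    sumTo (suc n) (λ j → μ (m ℤ.- + j) * ((p j - a * q j) - r j))
      ≈⟨ sumTo-cong (suc n) (λ j → solve 5 (λ x p q r a → x :* ((p :- a :* q) :- r) := (x :* p :- a :* (x :* q)) :- x :* r)
                                            refl (μ (m ℤ.- + j)) (p j) (q j) (r j) a) ⟩
    sumTo (suc n) (λ j → (μ (m ℤ.- + j) * p j - a * (μ (m ℤ.- + j) * q j)) - μ (m ℤ.- + j) * r j)
      ≈⟨ sumTo-sub (suc n) (λ j → μ (m ℤ.- + j) * p j - a * (μ (m ℤ.- + j) * q j)) (λ j → μ (m ℤ.- + j) * r j) ⟩
    sumTo (suc n) (λ j → μ (m ℤ.- + j) * p j - a * (μ (m ℤ.- + j) * q j)) - ⟨ m ∣ r ⟩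
      ≈⟨ +-congʳ (sumTo-sub (suc n) (λ j → μ (m ℤ.- + j) * p j) (λ j → a * (μ (m ℤ.- + j) * q j))) ⟩
    (⟨ m ∣ p ⟩ - sumTo (suc n) (λ j → a * (μ (m ℤ.- + j) * q j))) - ⟨ m ∣ r ⟩
      ≈⟨ +-congʳ (+-congˡ (-‿cong (sumTo-scaleˡ (suc n) a (λ j → μ (m ℤ.- + j) * q j)))) ⟩
    (⟨ m ∣ p ⟩ - a * ⟨ m ∣ q ⟩) - ⟨ m ∣ r ⟩ ∎

  -- multiplying by z lowers the exponent, as long as the degree stays at most n
  pair-shift : ∀ m p → p n ≈ 0# → ⟨ m ∣ shift p ⟩ ≈ ⟨ m ℤ.- + 1 ∣ p ⟩
  pair-shift m p pₙ≈0 = begin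
    μ (m ℤ.- + 0) * 0# + sumTo n (λ j → μ (m ℤ.- + suc j) * p j)
      ≈⟨ trans (+-congʳ (zeroʳ _)) (+-identityˡ _) ⟩
    sumTo n (λ j → μ (m ℤ.- + suc j) * p j)
      ≈⟨ sumTo-cong n (λ j → *-congʳ {p j} (reflexive (Eq.cong μ (minus-suc j)))) ⟩
    sumTo n (λ j → μ ((m ℤ.- + 1) ℤ.- + j) * p j)
      ≈⟨ +-identityʳ _ ⟨
    sumTo n (λ j → μ ((m ℤ.- + 1) ℤ.- + j) * p j) + 0#
      ≈⟨ +-congˡ (trans (*-congˡ pₙ≈0) (zeroʳ _)) ⟨
    sumTo n (λ j → μ ((m ℤ.- + 1) ℤ.- + j) * p j) + μ ((m ℤ.- + 1) ℤ.- + n) * p n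
      ≈⟨ sumTo-last n (λ j → μ ((m ℤ.- + 1) ℤ.- + j) * p j) ⟨
    ⟨ m ℤ.- + 1 ∣ p ⟩ ∎
    where
    minus-suc : ∀ j → m ℤ.- + suc j Eq.≡ (m ℤ.- + 1) ℤ.- + j
    minus-suc j = Eq.trans (Eq.cong (λ x → m ℤ.+ x) (neg-suc j)) (Eq.sym (ℤP.+-assoc m -[1+ 0 ] (ℤ.- + j)))
      where
      neg-suc : ∀ j → ℤ.- + suc j Eq.≡ -[1+ 0 ] ℤ.+ ℤ.- + j
      neg-suc zero = Eq.refl
      neg-suc (suc j) = Eq.refl

module ToeplitzSmithForm {c ℓ : Level} (R : CommutativeRing c ℓ) (b binv lam : ℕ → CommutativeRing.Carrier R)
  (b*binv≈1 : ∀ k → CommutativeRing._≈_ R (CommutativeRing._*_ R (b k) (binv k)) (CommutativeRing.1# R))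
  (n : ℕ) where
  open CommutativeRing R hiding (zero)
  open WithRing R
  open WithRing.Moments R b binv lam
  open IntegerRingSolver R using (solve; _:=_; _:+_; _:*_; :-_; _:-_; con)
  open FiniteSums R
  open Unitriangular R
  open Kronecker R
  open Pairing R μ n
  open import Relation.Binary.Reasoning.Setoid setoid
  module Pos = LatticePaths R wtE wtSE
  module Neg = LatticePaths R bwtE bwtSE

  mutual
    -- q k j is the coefficient of z^j in q_k
    q : ℕ → Poly
    q zero j = unit j
    q (suc k) j = (shift (q k) j - b k * q k j) - qLower k j

    -- the coefficients of z λ_k q_{k-1}(z), which is 0 for k = 0
    qLower : ℕ → Poly
    qLower zero j = 0#
    qLower (suc k) j = lam k * shift (q k) j

  mutual
    q-degree : ∀ k j → k < j → q k j ≈ 0#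
    q-degree zero (suc j) _ = refl
    q-degree (suc k) (suc j) (s≤s k<j) = begin
      (q k j - b k * q k (suc j)) - qLower k (suc j)
        ≈⟨ +-cong (+-cong (q-degree k j k<j) (-‿cong (*-congˡ (q-degree k (suc j) (ℕP.m<n⇒m<1+n k<j)))))
                  (-‿cong (qLower-degree k (suc j) (ℕP.m<n⇒m<1+n k<j))) ⟩
      (0# - b k * 0#) - 0#
        ≈⟨ solve 1 (λ x → (con (+ 0) :- x :* con (+ 0)) :- con (+ 0) := con (+ 0)) refl (b k) ⟩
      0# ∎

    qLower-degree : ∀ k j → k < j → qLower k j ≈ 0#
    qLower-degree zero j _ = refl
    qLower-degree (suc k) (suc j) (s≤s k<j) = trans (*-congˡ (q-degree k j k<j)) (zeroʳ (lam k))

  q-leading : ∀ k → q k k ≈ 1#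
  q-leading zero = refl
  q-leading (suc k) = begin
    (q k k - b k * q k (suc k)) - qLower k (suc k)
      ≈⟨ +-cong (+-cong (q-leading k) (-‿cong (*-congˡ (q-degree k (suc k) (ℕP.n<1+n k)))))
                (-‿cong (qLower-degree k (suc k) (ℕP.n<1+n k))) ⟩
    (1# - b k * 0#) - 0#
      ≈⟨ solve 1 (λ x → (con (+ 1) :- x :* con (+ 0)) :- con (+ 0) := con (+ 1)) refl (b k) ⟩
    1# ∎

  pair-q-suc : ∀ k → k < n → ∀ m → ⟨ m ∣ q (suc k) ⟩ ≈ (⟨ m ℤ.- + 1 ∣ q k ⟩ - b k * ⟨ m ∣ q k ⟩) - ⟨ m ∣ qLower k ⟩
  pair-q-suc k k<n m =
    trans (pair-combine m (b k) (shift (q k)) (q k) (qLower k))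
          (+-congʳ (+-congʳ (pair-shift m (q k) (q-degree k n k<n))))

  pair-qLower-suc : ∀ k → k < n → ∀ m → ⟨ m ∣ qLower (suc k) ⟩ ≈ lam k * ⟨ m ℤ.- + 1 ∣ q k ⟩
  pair-qLower-suc k k<n m = trans (pair-scale m (lam k) (shift (q k))) (*-congˡ (pair-shift m (q k) (q-degree k n k<n)))

  Π : ℕ → Carrier
  Π zero = b 0
  Π (suc k) = lam k * Π k

  closedForm : ℤ → ℕ → Carrier
  closedForm (+ m) k = d k * Pos.fromOrigin (m ℕ.+ m) k
  closedForm -[1+ j ] k = Π k * Neg.fromOrigin ((j ℕ.+ k) ℕ.+ (j ℕ.+ k)) k

  closedFormLower : ℕ → ℤ → Carrier
  closedFormLower zero m = 0#
  closedFormLower (suc k) m = lam k * closedForm (m ℤ.- + 1) k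

  closedForm-initial : ∀ m → μ m ≈ closedForm m 0
  closedForm-initial (+ m) = begin
    schroeder wtE wtSE (2 ℕ.* m) 0     ≈⟨ Pos.schroeder-walks (2 ℕ.* m) 0 ⟩
    Pos.walks (2 ℕ.* m) 0 0            ≡⟨ Eq.cong (λ t → Pos.walks (m ℕ.+ t) 0 0) (ℕP.+-identityʳ m) ⟩
    Pos.walks (m ℕ.+ m) 0 0            ≈⟨ *-identityˡ _ ⟨
    1# * Pos.fromOrigin (m ℕ.+ m) 0    ∎
  closedForm-initial -[1+ j ] = *-congˡ (begin
    schroeder bwtE bwtSE (2 ℕ.* j) 0            ≈⟨ Neg.schroeder-walks (2 ℕ.* j) 0 ⟩
    Neg.walks (j ℕ.+ (j ℕ.+ 0)) 0 0             ≡⟨ Eq.cong (λ t → Neg.walks (t ℕ.+ (j ℕ.+ 0)) 0 0) (ℕP.+-identityʳ j) ⟨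
    Neg.fromOrigin ((j ℕ.+ 0) ℕ.+ (j ℕ.+ 0)) 0  ∎)

  private
    cancel-unit : ∀ {x y} u z → u ≈ 1# → y ≈ x + (1# - u) * z → y ≈ x
    cancel-unit {x} {y} u z u≈1 y≈ = begin
      y                   ≈⟨ y≈ ⟩
      x + (1# - u) * z    ≈⟨ +-congˡ (*-congʳ (+-congˡ (-‿cong u≈1))) ⟩
      x + (1# - 1#) * z   ≈⟨ solve 2 (λ x z → x :+ (con (+ 1) :- con (+ 1)) :* z := x) refl x z ⟩
      x                   ∎

    positive-algebra : ∀ {A B C X} β β⁻¹ β′⁻¹ l δ → β * β⁻¹ ≈ 1# →
      C ≈ (X + (l * (β⁻¹ * β′⁻¹)) * A) + β⁻¹ * B →
      (- (l * β′⁻¹) * δ) * A ≈ (δ * B - β * (δ * C)) - (- (β * δ) * X)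
    positive-algebra {A} {B} {C} {X} β β⁻¹ β′⁻¹ l δ ββ⁻¹≈1 C≈ =
      sym (cancel-unit (β * β⁻¹) (δ * B + (l * β′⁻¹) * δ * A) ββ⁻¹≈1 (begin
        (δ * B - β * (δ * C)) - (- (β * δ) * X)
          ≈⟨ +-congʳ (+-congˡ (-‿cong (*-congˡ (*-congˡ C≈)))) ⟩
        (δ * B - β * (δ * ((X + (l * (β⁻¹ * β′⁻¹)) * A) + β⁻¹ * B))) - (- (β * δ) * X)
          ≈⟨ solve 8 (λ A B X β β⁻¹ β′⁻¹ l δ →
                (δ :* B :- β :* (δ :* ((X :+ (l :* (β⁻¹ :* β′⁻¹)) :* A) :+ β⁻¹ :* B))) :- (:- (β :* δ) :* X)
                := (:- (l :* β′⁻¹) :* δ) :* A :+ (con (+ 1) :- β :* β⁻¹) :* (δ :* B :+ (l :* β′⁻¹) :* δ :* A))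
              refl A B X β β⁻¹ β′⁻¹ l δ ⟩
        (- (l * β′⁻¹) * δ) * A + (1# - β * β⁻¹) * (δ * B + (l * β′⁻¹) * δ * A) ∎))

    -- the lower term of the positive closed forms: λ_k d_{k-1} = -b_k d_k, since d_k = -(λ_k / b_k) d_{k-1}
    lower-positive-algebra : ∀ β β⁻¹ l δ F → β * β⁻¹ ≈ 1# → l * (δ * F) ≈ - (β * (- (l * β⁻¹) * δ)) * F
    lower-positive-algebra β β⁻¹ l δ F ββ⁻¹≈1 = sym (cancel-unit (β * β⁻¹) (- (l * (δ * F))) ββ⁻¹≈1
      (solve 5 (λ β β⁻¹ l δ F → :- (β :* (:- (l :* β⁻¹) :* δ)) :* F
                                := l :* (δ :* F) :+ (con (+ 1) :- β :* β⁻¹) :* (:- (l :* (δ :* F))))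
             refl β β⁻¹ l δ F))

    negative-algebra : ∀ {A B C X} β l P → C ≈ (X + l * A) + β * B →
      (l * P) * A ≈ (P * C - β * (P * B)) - P * X
    negative-algebra {A} {B} {C} {X} β l P C≈ = sym (begin
      (P * C - β * (P * B)) - P * X
        ≈⟨ +-congʳ (+-congʳ (*-congˡ C≈)) ⟩
      (P * ((X + l * A) + β * B) - β * (P * B)) - P * X
        ≈⟨ solve 6 (λ A B X β l P → (P :* ((X :+ l :* A) :+ β :* B) :- β :* (P :* B)) :- P :* X := (l :* P) :* A)
                   refl A B X β l P ⟩
      (l * P) * A ∎)

  doubled : ∀ {a a′} → a Eq.≡ a′ → a ℕ.+ a Eq.≡ a′ ℕ.+ a′
  doubled = Eq.cong (λ x → x ℕ.+ x)

  suc-doubled : ∀ a → suc a ℕ.+ suc a Eq.≡ suc (suc (a ℕ.+ a))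
  suc-doubled a = Eq.cong suc (ℕP.+-suc a a)

  -- For m = 0 the recurrence reduces to Π (k+1) = λ_{k+1} Π k and to the steepest paths having weight one.
  closedForm-rec-zero : ∀ k →
    closedForm (+ 0) (suc k) ≈ (closedForm (+ 0 ℤ.- + 1) k - b k * closedForm (+ 0) k) - closedFormLower k (+ 0)
  closedForm-rec-zero zero =
    solve 2 (λ x y → x :* con (+ 0) := (y :* con (+ 1) :- y :* (con (+ 1) :* con (+ 1))) :- con (+ 0)) refl (d 1) (b 0)
  closedForm-rec-zero (suc k) = begin
    d (suc (suc k)) * 0#
      ≈⟨ solve 5 (λ x l P β δ → x :* con (+ 0) := ((l :* P) :* con (+ 1) :- β :* (δ :* con (+ 0))) :- l :* (P :* con (+ 1)))
                 refl (d (suc (suc k))) (lam k) (Π k) (b (suc k)) (d (suc k)) ⟩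
    ((lam k * Π k) * 1# - b (suc k) * (d (suc k) * 0#)) - lam k * (Π k * 1#)
      ≈⟨ +-cong (+-congʳ (*-congˡ (Neg.fromOrigin-top (suc k)))) (-‿cong (*-congˡ (*-congˡ (Neg.fromOrigin-top k)))) ⟨
    closedForm -[1+ 0 ] (suc k) - b (suc k) * closedForm (+ 0) (suc k) - closedFormLower (suc k) (+ 0) ∎

  -- For m > 0 the recurrence is the last-step decomposition of the weighted paths.
  closedForm-rec-positive : ∀ k m →
    closedForm (+ suc m) (suc k) ≈ (closedForm (+ m) k - b k * closedForm (+ suc m) k) - closedFormLower k (+ suc m)
  closedForm-rec-positive k m = begin
    d (suc k) * Pos.fromOrigin (suc m ℕ.+ suc m) (suc k)
      ≈⟨ *-congˡ (Pos.fromOrigin-cong (suc k) (suc-doubled m)) ⟩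
    d (suc k) * Pos.fromOrigin (2 ℕ.+ t) (suc k)
      ≈⟨ positive-algebra (b k) (binv k) (binv (suc k)) (lam k) (d k) (b*binv≈1 k) (Pos.fromOrigin-last t k) ⟩
    (d k * Pos.fromOrigin t k - b k * (d k * Pos.fromOrigin (2 ℕ.+ t) k)) - (- (b k * d k) * Pos.below t k)
      ≈⟨ +-cong (+-congˡ (-‿cong (*-congˡ (*-congˡ (Pos.fromOrigin-cong k (suc-doubled m)))))) (-‿cong (lower k)) ⟨
    (closedForm (+ m) k - b k * closedForm (+ suc m) k) - closedFormLower k (+ suc m) ∎
    where
    t : ℕ
    t = m ℕ.+ m
    lower : ∀ k → closedFormLower k (+ suc m) ≈ - (b k * d k) * Pos.below t k
    lower zero = sym (zeroʳ _)
    lower (suc k) = lower-positive-algebra (b (suc k)) (binv (suc k)) (lam k) (d k) _ (b*binv≈1 (suc k))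

  -- For m < 0 the recurrence is the last-step decomposition of the bar-weighted paths.
  closedForm-rec-negative : ∀ k j →
    closedForm -[1+ j ] (suc k) ≈ (closedForm (-[1+ j ] ℤ.- + 1) k - b k * closedForm -[1+ j ] k) - closedFormLower k -[1+ j ]
  closedForm-rec-negative k j = begin
    Π (suc k) * Neg.fromOrigin ((j ℕ.+ suc k) ℕ.+ (j ℕ.+ suc k)) (suc k)
      ≈⟨ *-congˡ (Neg.fromOrigin-cong (suc k) (Eq.trans (doubled (ℕP.+-suc j k)) (suc-doubled (j ℕ.+ k)))) ⟩
    (lam k * Π k) * Neg.fromOrigin (2 ℕ.+ t) (suc k)
      ≈⟨ negative-algebra (b k) (lam k) (Π k) (Neg.fromOrigin-last t k) ⟩
    (Π k * Neg.fromOrigin (2 ℕ.+ t) k - b k * (Π k * Neg.fromOrigin t k)) - Π k * Neg.below t k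
      ≈⟨ +-cong (+-congʳ (*-congˡ (Neg.fromOrigin-cong k (Eq.trans (doubled (j+1+k≡j+k+1 k)) (suc-doubled (j ℕ.+ k))))))
                (-‿cong (lower k)) ⟨
    (closedForm -[1+ suc (j ℕ.+ 0) ] k - b k * closedForm -[1+ j ] k) - closedFormLower k -[1+ j ] ∎
    where
    t : ℕ
    t = (j ℕ.+ k) ℕ.+ (j ℕ.+ k)
    -- the index of -[1+ j ] - 1, as it computes
    j+1+k≡j+k+1 : ∀ k → suc (j ℕ.+ 0) ℕ.+ k Eq.≡ suc (j ℕ.+ k)
    j+1+k≡j+k+1 k = Eq.cong (λ x → suc (x ℕ.+ k)) (ℕP.+-identityʳ j)
    lower : ∀ k → closedFormLower k -[1+ j ] ≈ Π k * Neg.below ((j ℕ.+ k) ℕ.+ (j ℕ.+ k)) k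
    lower zero = sym (zeroʳ _)
    lower (suc k) = begin
      lam k * (Π k * Neg.fromOrigin ((suc (j ℕ.+ 0) ℕ.+ k) ℕ.+ (suc (j ℕ.+ 0) ℕ.+ k)) k)
        ≈⟨ *-assoc _ _ _ ⟨
      Π (suc k) * Neg.fromOrigin ((suc (j ℕ.+ 0) ℕ.+ k) ℕ.+ (suc (j ℕ.+ 0) ℕ.+ k)) k
        ≈⟨ *-congˡ (Neg.fromOrigin-cong k (doubled (Eq.trans (j+1+k≡j+k+1 k) (Eq.sym (ℕP.+-suc j k))))) ⟩
      Π (suc k) * Neg.fromOrigin ((j ℕ.+ suc k) ℕ.+ (j ℕ.+ suc k)) k ∎

  closedForm-rec : ∀ k m → closedForm m (suc k) ≈ (closedForm (m ℤ.- + 1) k - b k * closedForm m k) - closedFormLower k m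
  closedForm-rec k (+ zero) = closedForm-rec-zero k
  closedForm-rec k (+ suc m) = closedForm-rec-positive k m
  closedForm-rec k -[1+ j ] = closedForm-rec-negative k j

  mutual
    pair-q : ∀ k → k ≤ n → ∀ m → ⟨ m ∣ q k ⟩ ≈ closedForm m k
    pair-q zero _ m = trans (pair-unit m) (closedForm-initial m)
    pair-q (suc k) k<n m = begin
      ⟨ m ∣ q (suc k) ⟩
        ≈⟨ pair-q-suc k k<n m ⟩
      (⟨ m ℤ.- + 1 ∣ q k ⟩ - b k * ⟨ m ∣ q k ⟩) - ⟨ m ∣ qLower k ⟩
        ≈⟨ +-cong (+-cong (pair-q k k≤n (m ℤ.- + 1)) (-‿cong (*-congˡ (pair-q k k≤n m)))) (-‿cong (pair-qLower k k<n m)) ⟩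
      (closedForm (m ℤ.- + 1) k - b k * closedForm m k) - closedFormLower k m
        ≈⟨ closedForm-rec k m ⟨
      closedForm m (suc k) ∎
      where
      k≤n : k ≤ n
      k≤n = ℕP.<⇒≤ k<n

    pair-qLower : ∀ k → k < n → ∀ m → ⟨ m ∣ qLower k ⟩ ≈ closedFormLower k m
    pair-qLower zero _ m = sumTo-zero (suc n) (λ j → zeroʳ (μ (m ℤ.- + j)))
    pair-qLower (suc k) k+1<n m =
      trans (pair-qLower-suc k k<n m) (*-congˡ (pair-q k (ℕP.<⇒≤ k<n) (m ℤ.- + 1)))
      where
      k<n : k < n
      k<n = ℕP.<-trans (ℕP.n<1+n k) k+1<n

  pathArray : Array
  pathArray l k = Pos.fromOrigin (l ℕ.+ l) k

  pathArray-diag : ∀ k → pathArray k k ≈ 1#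
  pathArray-diag = Pos.fromOrigin-top

  pathArray-upper : ∀ l k → l < k → pathArray l k ≈ 0#
  pathArray-upper l k l<k = Pos.fromOrigin-vanish (l ℕ.+ l) k (ℕP.+-mono-< l<k l<k)

  rowOps colOps : Matrix (suc n) (suc n)
  rowOps i j = lowerInverse (suc n) pathArray (toℕ i) (toℕ j)
  colOps i j = q (toℕ j) (toℕ i)

  rowOps-SL : InSL (suc n) rowOps
  rowOps-SL = det-lowerUnitriangular (suc n) rowOps
    (λ i → lowerInverse-diag (suc n) pathArray (toℕ i) (FinP.toℕ<n i))
    (λ i j i<j → lowerInverse-upper (suc n) pathArray (toℕ i) (toℕ j) i<j)

  colOps-SL : InSL (suc n) colOps
  colOps-SL = det-upperUnitriangular (suc n) colOps (λ i → q-leading (toℕ i)) (λ i j j<i → q-degree (toℕ j) (toℕ i) j<i)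

  toeplitz-colOps : ∀ l k → (toeplitz n ⊗ colOps) l k ≈ d (toℕ k) * pathArray (toℕ l) (toℕ k)
  toeplitz-colOps l k =
    trans (Σ≈sum (suc n) (λ j → *-congʳ {q (toℕ k) (toℕ j)}
                                          (reflexive (Eq.cong μ (Eq.sym (ℤP.[+m]-[+n]≡m⊖n (toℕ l) (toℕ j)))))))
          (pair-q (toℕ k) (ℕP.≤-pred (FinP.toℕ<n k)) (+ toℕ l))

  -- Row operations then invert pathArray.
  transformed : ∀ i k → ((rowOps ⊗ toeplitz n) ⊗ colOps) i k ≈ δ (toℕ i) (toℕ k) * d (toℕ k)
  transformed i k = begin
    ((rowOps ⊗ toeplitz n) ⊗ colOps) i k
      ≈⟨ ⊗-assoc rowOps (toeplitz n) colOps i k ⟩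
    (rowOps ⊗ (toeplitz n ⊗ colOps)) i k
      ≈⟨ Σ≈sum (suc n) (λ l → *-congˡ {P i′ (toℕ l)} (toeplitz-colOps l k)) ⟩
    sumTo (suc n) (λ l → P i′ l * (d k′ * pathArray l k′))
      ≈⟨ sumTo-cong (suc n) (λ l → solve 3 (λ x y z → x :* (y :* z) := (x :* z) :* y)
                                             refl (P i′ l) (d k′) (pathArray l k′)) ⟩
    sumTo (suc n) (λ l → (P i′ l * pathArray l k′) * d k′)
      ≈⟨ sumTo-scaleʳ (suc n) (d k′) (λ l → P i′ l * pathArray l k′) ⟩
    sumTo (suc n) (λ l → P i′ l * pathArray l k′) * d k′
      ≈⟨ *-congʳ (lowerInverse-left (suc n) pathArray pathArray-diag pathArray-upper i′ k′ (FinP.toℕ<n i) (FinP.toℕ<n k)) ⟩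
    δ i′ k′ * d k′ ∎
    where
    P : ℕ → ℕ → Carrier
    P = lowerInverse (suc n) pathArray
    i′ k′ : ℕ
    i′ = toℕ i
    k′ = toℕ k

  diagMat-entry : ∀ i k → δ (toℕ i) (toℕ k) * d (toℕ k) ≈ diagMat n i k
  diagMat-entry i k with i Fin.≟ k
  ... | yes Eq.refl = trans (*-congʳ (δ-diag (toℕ i))) (*-identityˡ _)
  ... | no i≢k = trans (*-congʳ (δ-off _ _ (λ i≡k → i≢k (FinP.toℕ-injective i≡k)))) (zeroˡ _)

  rowOps-toeplitz-colOps : ((rowOps ⊗ toeplitz n) ⊗ colOps) ≋ diagMat n
  rowOps-toeplitz-colOps i k = trans (transformed i k) (diagMat-entry i k)

  diagMat-diagonal : IsDiagonal (diagMat n)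
  diagMat-diagonal i k i≢k with i Fin.≟ k
  ... | yes i≡k = ⊥-elim (i≢k i≡k)
  ... | no _ = refl

  diagMat-diag : ∀ i → diagMat n i i ≈ d (toℕ i)
  diagMat-diag i with i Fin.≟ i
  ... | yes _ = refl
  ... | no i≢i = ⊥-elim (i≢i Eq.refl)

  d-divides : ∀ {j k} → j ℕ.≤′ k → d j ∣ᴿ d k
  d-divides (ℕ.≤′-reflexive Eq.refl) = 1# , sym (*-identityˡ _)
  d-divides {k = suc k} (ℕ.≤′-step j≤k) =
    let (r , dk≈r*dj) = d-divides j≤k in
    (- (lam k * binv (suc k)) * r) , trans (*-congˡ dk≈r*dj) (sym (*-assoc _ _ _))

  diagMat-divides : ∀ (i j : Fin (suc n)) → toℕ j ≤ toℕ i → diagMat n j j ∣ᴿ diagMat n i i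
  diagMat-divides i j j≤i =
    let (r , di≈r*dj) = d-divides (ℕP.≤⇒≤′ j≤i) in
    r , trans (diagMat-diag i) (trans di≈r*dj (*-congˡ (sym (diagMat-diag j))))

theorem6p1 : {c ℓ : Level} (R : CommutativeRing c ℓ)
    (b binv lam : ℕ → CommutativeRing.Carrier R) →
    (∀ k → CommutativeRing._≈_ R (CommutativeRing._*_ R (b k) (binv k)) (CommutativeRing.1# R)) →
    (n : ℕ) →
    WithRing.IsSSNF R (suc n) (WithRing.Moments.toeplitz R b binv lam n) (WithRing.Moments.diagMat R b binv lam n)
theorem6p1 R b binv lam b*binv≈1 n =
  rowOps , colOps , rowOps-SL , colOps-SL , rowOps-toeplitz-colOps , diagMat-diagonal , diagMat-divides
  where open ToeplitzSmithForm R b binv lam b*binv≈1 n
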